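{- (1) If a propositional formula $\varphi$ is $\mathbf{GD}$-valid, then $\mathbf{HLJ}'+(\mathrm{ls})$ derives the hypersequent $\Rightarrow\varphi$. (2) If a formula $\varphi$ is $\forall\mathbf{INT}+\mathsf{LIN}$-valid, then $\forall\mathbf{HLJ}'+(\forall\text{ - }\mathrm{R_{ms}})+(\mathrm{ls})$ derives the hypersequent $\Rightarrow\varphi$.
   Context: Formulas are built from atoms and $\bot$ with $\land,\lor,\to$ (and, in the predicate case, $\forall,\exists$). A sequent $\Gamma\Rightarrow\Delta$ consists of finite sequences of formulas; a hypersequent is a finite sequence of sequents $\Gamma_1\Rightarrow\Delta_1\mid\cdots\mid\Gamma_n\Rightarrow\Delta_n$; $G,H$ denote possibly empty hypersequents, $S,T$ sequents. $\mathbf{HLK}$ has: axioms $\varphi\Rightarrow\varphi$, $\bot\Rightarrow\varphi$; external weakening (from $G$ infer $S\mid G$), contraction (from $S\mid S\mid G$ infer $S\mid G$), exchange (from $G\mid S\mid T\mid H$ infer $G\mid T\mid S\mid H$); internal weakening, contraction and exchange on either side of a component, with arbitrary side hypersequent $G$; cut: from $\Gamma_0\Rightarrow\Delta_0,\delta\mid G$ and $\delta,\Gamma_1\Rightarrow\Delta_1\mid G$ infer $\Gamma_0,\Gamma_1\Rightarrow\Delta_0,\Delta_1\mid G$; logical rules with side hypersequent $G$: from $\varphi_i,\Gamma\Rightarrow\Delta\mid G$ infer $\varphi_1\land\varphi_2,\Gamma\Rightarrow\Delta\mid G$; from $\Gamma\Rightarrow\Delta,\varphi_1\mid G$ and $\Gamma\Rightarrow\Delta,\varphi_2\mid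 G$ infer $\Gamma\Rightarrow\Delta,\varphi_1\land\varphi_2\mid G$; from $\varphi_1,\Gamma\Rightarrow\Delta\mid G$ and $\varphi_2,\Gamma\Rightarrow\Delta\mid G$ infer $\varphi_1\lor\varphi_2,\Gamma\Rightarrow\Delta\mid G$; from $\Gamma\Rightarrow\Delta,\varphi_i\mid G$ infer $\Gamma\Rightarrow\Delta,\varphi_1\lor\varphi_2\mid G$; from $\Gamma\Rightarrow\Delta,\varphi\mid G$ and $\psi,\Gamma\Rightarrow\Delta\mid G$ infer $\varphi\to\psi,\Gamma\Rightarrow\Delta\mid G$; from $\varphi,\Gamma\Rightarrow\Delta,\psi\mid G$ infer $\Gamma\Rightarrow\Delta,\varphi\to\psi\mid G$. $\mathbf{HLJ}'$ is $\mathbf{HLK}$ with the last rule replaced by: from $\varphi,\Gamma\Rightarrow\psi\mid G$ infer $\Gamma\Rightarrow\varphi\to\psi\mid G$. $\forall\mathbf{HLJ}'$ is $\mathbf{HLJ}'$ plus: from $[t/x]\varphi,\Gamma\Rightarrow\Delta\mid G$ infer $\forall x\varphi,\Gamma\Rightarrow\Delta\mid G$; from $\Gamma\Rightarrow\varphi$ infer $\Gamma\Rightarrow\forall x\varphi$ (single component, $x$ not free in $\Gamma$); from $\varphi,\Gamma\Rightarrow\Delta$ infer $\exists x\varphi,\Gamma\Rightarrow\Delta$ (single component, $x$ not free in $\Gamma,\Delta$); from $\Gamma\Rightarrow\Delta,[t/x]\psi\mid G$ infer $\Gamma\Rightarrow\Delta,\exists x\psi\mid G$. $(\forall\text{ -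 }\mathrm{R_{ms}})$: from $\Gamma\Rightarrow\varphi\mid G$ infer $\Gamma\Rightarrow\forall x\varphi\mid G$, $x$ not free in the conclusion. $(\mathrm{ls})$: from $\Gamma_1,\Gamma_2\Rightarrow\Delta\mid G$ infer $\Gamma_1\Rightarrow\Delta\mid\Gamma_2\Rightarrow\Delta\mid G$. $\mathbf{GD}$ is intuitionistic propositional logic plus the schema $\mathsf{LIN}\colon(\varphi\to\psi)\lor(\psi\to\varphi)$; $\forall\mathbf{INT}+\mathsf{LIN}$ is intuitionistic predicate logic plus $\mathsf{LIN}$. "$L$-valid" means valid (equivalently provable) in $L$. -}

module Defs where

open import Data.Nat using (ℕ; zero; suc)
open import Data.List using (List; []; _∷_; _++_; [_])

module Prop where

  infixr 8 _∧_
  infixr 7 _∨_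
  infixr 6 _⇒ᶠ_

  data Fml : Set where
    atom  : ℕ → Fml
    ⊥'    : Fml
    _∧_   : Fml → Fml → Fml
    _∨_   : Fml → Fml → Fml
    _⇒ᶠ_  : Fml → Fml → Fml

  -- GD = intuitionistic propositional logic + LIN, as a Hilbert system
  data GD⊢_ : Fml → Set where
    K    : ∀ {φ ψ} → GD⊢ (φ ⇒ᶠ (ψ ⇒ᶠ φ))
    S    : ∀ {φ ψ χ} → GD⊢ ((φ ⇒ᶠ (ψ ⇒ᶠ χ)) ⇒ᶠ ((φ ⇒ᶠ ψ) ⇒ᶠ (φ ⇒ᶠ χ)))
    ∧E₁  : ∀ {φ ψ} → GD⊢ ((φ ∧ ψ) ⇒ᶠ φ)
    ∧E₂  : ∀ {φ ψ} → GD⊢ ((φ ∧ ψ) ⇒ᶠ ψ)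
    ∧I   : ∀ {φ ψ} → GD⊢ (φ ⇒ᶠ (ψ ⇒ᶠ (φ ∧ ψ)))
    ∨I₁  : ∀ {φ ψ} → GD⊢ (φ ⇒ᶠ (φ ∨ ψ))
    ∨I₂  : ∀ {φ ψ} → GD⊢ (ψ ⇒ᶠ (φ ∨ ψ))
    ∨E   : ∀ {φ ψ χ} → GD⊢ ((φ ⇒ᶠ χ) ⇒ᶠ ((ψ ⇒ᶠ χ) ⇒ᶠ ((φ ∨ ψ) ⇒ᶠ χ)))
    efq  : ∀ {φ} → GD⊢ (⊥' ⇒ᶠ φ)
    lin  : ∀ {φ ψ} → GD⊢ ((φ ⇒ᶠ ψ) ∨ (ψ ⇒ᶠ φ))
    mp   : ∀ {φ ψ} → GD⊢ (φ ⇒ᶠ ψ) → GD⊢ φ → GD⊢ ψ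

  infix 3 _⇒_
  data Seq : Set where
    _⇒_ : List Fml → List Fml → Seq

  Hyp : Set
  Hyp = List Seq

  -- derivability in HLJ' + (ls).  "S | G" is  S ∷ G;  "φ, Γ" is  φ ∷ Γ;
  -- "Δ, φ" is  Δ ++ [ φ ].
  data HLJ'ls⊢_ : Hyp → Set where
    ax    : ∀ {φ} → HLJ'ls⊢ ([ (φ ∷ [] ⇒ φ ∷ []) ])
    ax⊥   : ∀ {φ} → HLJ'ls⊢ ([ (⊥' ∷ [] ⇒ φ ∷ []) ])
    EW    : ∀ {S G} → HLJ'ls⊢ G → HLJ'ls⊢ (S ∷ G)
    EC    : ∀ {S G} → HLJ'ls⊢ (S ∷ S ∷ G) → HLJ'ls⊢ (S ∷ G)
    EE    : ∀ {G S T H} → HLJ'ls⊢ (G ++ S ∷ T ∷ H) → HLJ'ls⊢ (G ++ T ∷ S ∷ H)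
    IWL   : ∀ {φ Γ Δ G} → HLJ'ls⊢ ((Γ ⇒ Δ) ∷ G) → HLJ'ls⊢ ((φ ∷ Γ ⇒ Δ) ∷ G)
    IWR   : ∀ {φ Γ Δ G} → HLJ'ls⊢ ((Γ ⇒ Δ) ∷ G) → HLJ'ls⊢ ((Γ ⇒ Δ ++ [ φ ]) ∷ G)
    ICL   : ∀ {φ Γ Δ G} → HLJ'ls⊢ ((φ ∷ φ ∷ Γ ⇒ Δ) ∷ G) → HLJ'ls⊢ ((φ ∷ Γ ⇒ Δ) ∷ G)
    ICR   : ∀ {φ Γ Δ G} → HLJ'ls⊢ ((Γ ⇒ Δ ++ φ ∷ φ ∷ []) ∷ G) → HLJ'ls⊢ ((Γ ⇒ Δ ++ [ φ ]) ∷ G)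
    IEL   : ∀ {Γ φ ψ Γ' Δ G} → HLJ'ls⊢ ((Γ ++ φ ∷ ψ ∷ Γ' ⇒ Δ) ∷ G)
                             → HLJ'ls⊢ ((Γ ++ ψ ∷ φ ∷ Γ' ⇒ Δ) ∷ G)
    IER   : ∀ {Γ Δ φ ψ Δ' G} → HLJ'ls⊢ ((Γ ⇒ Δ ++ φ ∷ ψ ∷ Δ') ∷ G)
                             → HLJ'ls⊢ ((Γ ⇒ Δ ++ ψ ∷ φ ∷ Δ') ∷ G)
    cut   : ∀ {Γ₀ Δ₀ δ Γ₁ Δ₁ G} → HLJ'ls⊢ ((Γ₀ ⇒ Δ₀ ++ [ δ ]) ∷ G) → HLJ'ls⊢ ((δ ∷ Γ₁ ⇒ Δ₁) ∷ G)
          → HLJ'ls⊢ ((Γ₀ ++ Γ₁ ⇒ Δ₀ ++ Δ₁) ∷ G)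
    ∧L₁   : ∀ {φ₁ φ₂ Γ Δ G} → HLJ'ls⊢ ((φ₁ ∷ Γ ⇒ Δ) ∷ G) → HLJ'ls⊢ ((φ₁ ∧ φ₂ ∷ Γ ⇒ Δ) ∷ G)
    ∧L₂   : ∀ {φ₁ φ₂ Γ Δ G} → HLJ'ls⊢ ((φ₂ ∷ Γ ⇒ Δ) ∷ G) → HLJ'ls⊢ ((φ₁ ∧ φ₂ ∷ Γ ⇒ Δ) ∷ G)
    ∧R    : ∀ {φ₁ φ₂ Γ Δ G} → HLJ'ls⊢ ((Γ ⇒ Δ ++ [ φ₁ ]) ∷ G) → HLJ'ls⊢ ((Γ ⇒ Δ ++ [ φ₂ ]) ∷ G)
          → HLJ'ls⊢ ((Γ ⇒ Δ ++ [ φ₁ ∧ φ₂ ]) ∷ G)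
    ∨L    : ∀ {φ₁ φ₂ Γ Δ G} → HLJ'ls⊢ ((φ₁ ∷ Γ ⇒ Δ) ∷ G) → HLJ'ls⊢ ((φ₂ ∷ Γ ⇒ Δ) ∷ G)
          → HLJ'ls⊢ ((φ₁ ∨ φ₂ ∷ Γ ⇒ Δ) ∷ G)
    ∨R₁   : ∀ {φ₁ φ₂ Γ Δ G} → HLJ'ls⊢ ((Γ ⇒ Δ ++ [ φ₁ ]) ∷ G) → HLJ'ls⊢ ((Γ ⇒ Δ ++ [ φ₁ ∨ φ₂ ]) ∷ G)
    ∨R₂   : ∀ {φ₁ φ₂ Γ Δ G} → HLJ'ls⊢ ((Γ ⇒ Δ ++ [ φ₂ ]) ∷ G) → HLJ'ls⊢ ((Γ ⇒ Δ ++ [ φ₁ ∨ φ₂ ]) ∷ G)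
    →L    : ∀ {φ ψ Γ Δ G} → HLJ'ls⊢ ((Γ ⇒ Δ ++ [ φ ]) ∷ G) → HLJ'ls⊢ ((ψ ∷ Γ ⇒ Δ) ∷ G)
          → HLJ'ls⊢ ((φ ⇒ᶠ ψ ∷ Γ ⇒ Δ) ∷ G)
    -- the intuitionistic (single-succedent) →R of HLJ'
    →R'   : ∀ {φ ψ Γ G} → HLJ'ls⊢ ((φ ∷ Γ ⇒ [ ψ ]) ∷ G) → HLJ'ls⊢ ((Γ ⇒ [ φ ⇒ᶠ ψ ]) ∷ G)
    ls    : ∀ {Γ₁ Γ₂ Δ G} → HLJ'ls⊢ ((Γ₁ ++ Γ₂ ⇒ Δ) ∷ G) → HLJ'ls⊢ ((Γ₁ ⇒ Δ) ∷ (Γ₂ ⇒ Δ) ∷ G)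

module Pred where

  -- first-order terms: variables (de Bruijn indices) and function symbols
  data Term : Set where
    var : ℕ → Term
    fun : ℕ → List Term → Term

  mutual
    subT : (ℕ → Term) → Term → Term
    subT σ (var n)    = σ n
    subT σ (fun f ts) = fun f (subTs σ ts)

    subTs : (ℕ → Term) → List Term → List Term
    subTs σ []       = []
    subTs σ (t ∷ ts) = subT σ t ∷ subTs σ ts

  shiftT : Term → Term
  shiftT = subT (λ n → var (suc n))

  liftσ : (ℕ → Term) → (ℕ → Term)
  liftσ σ zero    = var zero
  liftσ σ (suc n) = shiftT (σ n)

  infixr 8 _∧_
  infixr 7 _∨_
  infixr 6 _⇒ᶠ_

  -- formulas: atoms P(t₁,…,tₙ), ⊥, ∧, ∨, →, ∀, ∃  (∀ and ∃ bind index 0)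
  data Fml : Set where
    atom  : ℕ → List Term → Fml
    ⊥'    : Fml
    _∧_   : Fml → Fml → Fml
    _∨_   : Fml → Fml → Fml
    _⇒ᶠ_  : Fml → Fml → Fml
    ∀'    : Fml → Fml
    ∃'    : Fml → Fml

  subF : (ℕ → Term) → Fml → Fml
  subF σ (atom P ts) = atom P (subTs σ ts)
  subF σ ⊥'          = ⊥'
  subF σ (φ ∧ ψ)     = subF σ φ ∧ subF σ ψ
  subF σ (φ ∨ ψ)     = subF σ φ ∨ subF σ ψ
  subF σ (φ ⇒ᶠ ψ)    = subF σ φ ⇒ᶠ subF σ ψ
  subF σ (∀' φ)      = ∀' (subF (liftσ σ) φ)
  subF σ (∃' φ)      = ∃' (subF (liftσ σ) φ)

  -- ↑ φ : φ viewed one binder deeper (the bound variable x does not occur free in ↑ φ)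
  ↑ : Fml → Fml
  ↑ = subF (λ n → var (suc n))

  ↑s : List Fml → List Fml
  ↑s []       = []
  ↑s (φ ∷ Γ) = ↑ φ ∷ ↑s Γ

  -- [t/x]φ for the body φ of ∀x φ / ∃x φ
  inst : Fml → Term → Fml
  inst φ t = subF σ φ
    where
      σ : ℕ → Term
      σ zero    = t
      σ (suc n) = var n

  -- ∀INT + LIN as a Hilbert system
  data IL⊢_ : Fml → Set where
    K    : ∀ {φ ψ} → IL⊢ (φ ⇒ᶠ (ψ ⇒ᶠ φ))
    S    : ∀ {φ ψ χ} → IL⊢ ((φ ⇒ᶠ (ψ ⇒ᶠ χ)) ⇒ᶠ ((φ ⇒ᶠ ψ) ⇒ᶠ (φ ⇒ᶠ χ)))
    ∧E₁  : ∀ {φ ψ} → IL⊢ ((φ ∧ ψ) ⇒ᶠ φ)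
    ∧E₂  : ∀ {φ ψ} → IL⊢ ((φ ∧ ψ) ⇒ᶠ ψ)
    ∧I   : ∀ {φ ψ} → IL⊢ (φ ⇒ᶠ (ψ ⇒ᶠ (φ ∧ ψ)))
    ∨I₁  : ∀ {φ ψ} → IL⊢ (φ ⇒ᶠ (φ ∨ ψ))
    ∨I₂  : ∀ {φ ψ} → IL⊢ (ψ ⇒ᶠ (φ ∨ ψ))
    ∨E   : ∀ {φ ψ χ} → IL⊢ ((φ ⇒ᶠ χ) ⇒ᶠ ((ψ ⇒ᶠ χ) ⇒ᶠ ((φ ∨ ψ) ⇒ᶠ χ)))
    efq  : ∀ {φ} → IL⊢ (⊥' ⇒ᶠ φ)
    lin  : ∀ {φ ψ} → IL⊢ ((φ ⇒ᶠ ψ) ∨ (ψ ⇒ᶠ φ))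
    mp   : ∀ {φ ψ} → IL⊢ (φ ⇒ᶠ ψ) → IL⊢ φ → IL⊢ ψ
    ∀E   : ∀ {φ t} → IL⊢ (∀' φ ⇒ᶠ inst φ t)
    ∃I   : ∀ {φ t} → IL⊢ (inst φ t ⇒ᶠ ∃' φ)
    ∀I   : ∀ {ψ φ} → IL⊢ (↑ ψ ⇒ᶠ φ) → IL⊢ (ψ ⇒ᶠ ∀' φ)      -- x not free in ψ
    ∃E   : ∀ {ψ φ} → IL⊢ (φ ⇒ᶠ ↑ ψ) → IL⊢ (∃' φ ⇒ᶠ ψ)      -- x not free in ψ

  infix 3 _⇒_
  data Seq : Set where
    _⇒_ : List Fml → List Fml → Seq

  Hyp : Set
  Hyp = List Seq

  ↑H : Hyp → Hyp
  ↑H []             = []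
  ↑H ((Γ ⇒ Δ) ∷ G) = (↑s Γ ⇒ ↑s Δ) ∷ ↑H G

  data D⊢_ : Hyp → Set where
    ax    : ∀ {φ} → D⊢ ([ (φ ∷ [] ⇒ φ ∷ []) ])
    ax⊥   : ∀ {φ} → D⊢ ([ (⊥' ∷ [] ⇒ φ ∷ []) ])
    EW    : ∀ {S G} → D⊢ G → D⊢ (S ∷ G)
    EC    : ∀ {S G} → D⊢ (S ∷ S ∷ G) → D⊢ (S ∷ G)
    EE    : ∀ {G S T H} → D⊢ (G ++ S ∷ T ∷ H) → D⊢ (G ++ T ∷ S ∷ H)
    IWL   : ∀ {φ Γ Δ G} → D⊢ ((Γ ⇒ Δ) ∷ G) → D⊢ ((φ ∷ Γ ⇒ Δ) ∷ G)
    IWR   : ∀ {φ Γ Δ G} → D⊢ ((Γ ⇒ Δ) ∷ G) → D⊢ ((Γ ⇒ Δ ++ [ φ ]) ∷ G)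
    ICL   : ∀ {φ Γ Δ G} → D⊢ ((φ ∷ φ ∷ Γ ⇒ Δ) ∷ G) → D⊢ ((φ ∷ Γ ⇒ Δ) ∷ G)
    ICR   : ∀ {φ Γ Δ G} → D⊢ ((Γ ⇒ Δ ++ φ ∷ φ ∷ []) ∷ G) → D⊢ ((Γ ⇒ Δ ++ [ φ ]) ∷ G)
    IEL   : ∀ {Γ φ ψ Γ' Δ G} → D⊢ ((Γ ++ φ ∷ ψ ∷ Γ' ⇒ Δ) ∷ G)
                             → D⊢ ((Γ ++ ψ ∷ φ ∷ Γ' ⇒ Δ) ∷ G)
    IER   : ∀ {Γ Δ φ ψ Δ' G} → D⊢ ((Γ ⇒ Δ ++ φ ∷ ψ ∷ Δ') ∷ G)
                             → D⊢ ((Γ ⇒ Δ ++ ψ ∷ φ ∷ Δ') ∷ G)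
    cut   : ∀ {Γ₀ Δ₀ δ Γ₁ Δ₁ G} → D⊢ ((Γ₀ ⇒ Δ₀ ++ [ δ ]) ∷ G) → D⊢ ((δ ∷ Γ₁ ⇒ Δ₁) ∷ G)
          → D⊢ ((Γ₀ ++ Γ₁ ⇒ Δ₀ ++ Δ₁) ∷ G)
    ∧L₁   : ∀ {φ₁ φ₂ Γ Δ G} → D⊢ ((φ₁ ∷ Γ ⇒ Δ) ∷ G) → D⊢ ((φ₁ ∧ φ₂ ∷ Γ ⇒ Δ) ∷ G)
    ∧L₂   : ∀ {φ₁ φ₂ Γ Δ G} → D⊢ ((φ₂ ∷ Γ ⇒ Δ) ∷ G) → D⊢ ((φ₁ ∧ φ₂ ∷ Γ ⇒ Δ) ∷ G)
    ∧R    : ∀ {φ₁ φ₂ Γ Δ G} → D⊢ ((Γ ⇒ Δ ++ [ φ₁ ]) ∷ G) → D⊢ ((Γ ⇒ Δ ++ [ φ₂ ]) ∷ G)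
          → D⊢ ((Γ ⇒ Δ ++ [ φ₁ ∧ φ₂ ]) ∷ G)
    ∨L    : ∀ {φ₁ φ₂ Γ Δ G} → D⊢ ((φ₁ ∷ Γ ⇒ Δ) ∷ G) → D⊢ ((φ₂ ∷ Γ ⇒ Δ) ∷ G)
          → D⊢ ((φ₁ ∨ φ₂ ∷ Γ ⇒ Δ) ∷ G)
    ∨R₁   : ∀ {φ₁ φ₂ Γ Δ G} → D⊢ ((Γ ⇒ Δ ++ [ φ₁ ]) ∷ G) → D⊢ ((Γ ⇒ Δ ++ [ φ₁ ∨ φ₂ ]) ∷ G)
    ∨R₂   : ∀ {φ₁ φ₂ Γ Δ G} → D⊢ ((Γ ⇒ Δ ++ [ φ₂ ]) ∷ G) → D⊢ ((Γ ⇒ Δ ++ [ φ₁ ∨ φ₂ ]) ∷ G)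
    →L    : ∀ {φ ψ Γ Δ G} → D⊢ ((Γ ⇒ Δ ++ [ φ ]) ∷ G) → D⊢ ((ψ ∷ Γ ⇒ Δ) ∷ G)
          → D⊢ ((φ ⇒ᶠ ψ ∷ Γ ⇒ Δ) ∷ G)
    →R'   : ∀ {φ ψ Γ G} → D⊢ ((φ ∷ Γ ⇒ [ ψ ]) ∷ G) → D⊢ ((Γ ⇒ [ φ ⇒ᶠ ψ ]) ∷ G)
    ∀L    : ∀ {φ t Γ Δ G} → D⊢ ((inst φ t ∷ Γ ⇒ Δ) ∷ G) → D⊢ ((∀' φ ∷ Γ ⇒ Δ) ∷ G)
    ∀R    : ∀ {φ Γ} → D⊢ ([ (↑s Γ ⇒ [ φ ]) ]) → D⊢ ([ (Γ ⇒ [ ∀' φ ]) ])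
    ∃L    : ∀ {φ Γ Δ} → D⊢ ([ (φ ∷ ↑s Γ ⇒ ↑s Δ) ]) → D⊢ ([ (∃' φ ∷ Γ ⇒ Δ) ])
    ∃R    : ∀ {ψ t Γ Δ G} → D⊢ ((Γ ⇒ Δ ++ [ inst ψ t ]) ∷ G) → D⊢ ((Γ ⇒ Δ ++ [ ∃' ψ ]) ∷ G)
    ∀Rms  : ∀ {φ Γ G} → D⊢ ((↑s Γ ⇒ [ φ ]) ∷ ↑H G) → D⊢ ((Γ ⇒ [ ∀' φ ]) ∷ G)
    ls    : ∀ {Γ₁ Γ₂ Δ G} → D⊢ ((Γ₁ ++ Γ₂ ⇒ Δ) ∷ G) → D⊢ ((Γ₁ ⇒ Δ) ∷ (Γ₂ ⇒ Δ) ∷ G)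

{-# OPTIONS --safe #-}
-- Each calculus derives every Hilbert axiom of its logic and is closed under modus
-- ponens (by cut), so derivations translate by induction.  The only axiom beyond
-- intuitionistic logic is LIN, and this is exactly where (ls) is needed.
module Submission where

open import Defs
open import Data.List using (List; []; _∷_; [_]; _++_)
open import Data.Product using (_×_; _,_)

record HLJ'lsExtension : Set₁ where
  infixr 8 _∧_
  infixr 7 _∨_
  infixr 6 _⇒ᶠ_
  infix 3 _⇒_
  field
    Fml  : Set
    ⊥'   : Fml
    _∧_ _∨_ _⇒ᶠ_ : Fml → Fml → Fml
    Seq  : Set
    _⇒_  : List Fml → List Fml → Seq
    ⊢_   : List Seq → Set
    ax   : ∀ {φ} → ⊢ [ (φ ∷ [] ⇒ φ ∷ []) ]
    ax⊥  : ∀ {φ} → ⊢ [ (⊥' ∷ [] ⇒ φ ∷ []) ]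
    EW   : ∀ {S G} → ⊢ G → ⊢ (S ∷ G)
    EC   : ∀ {S G} → ⊢ (S ∷ S ∷ G) → ⊢ (S ∷ G)
    EE   : ∀ {G S T H} → ⊢ (G ++ S ∷ T ∷ H) → ⊢ (G ++ T ∷ S ∷ H)
    IWL  : ∀ {φ Γ Δ G} → ⊢ ((Γ ⇒ Δ) ∷ G) → ⊢ ((φ ∷ Γ ⇒ Δ) ∷ G)
    IWR  : ∀ {φ Γ Δ G} → ⊢ ((Γ ⇒ Δ) ∷ G) → ⊢ ((Γ ⇒ Δ ++ [ φ ]) ∷ G)
    IEL  : ∀ {Γ φ ψ Γ' Δ G} → ⊢ ((Γ ++ φ ∷ ψ ∷ Γ' ⇒ Δ) ∷ G) → ⊢ ((Γ ++ ψ ∷ φ ∷ Γ' ⇒ Δ) ∷ G)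
    IER  : ∀ {Γ Δ φ ψ Δ' G} → ⊢ ((Γ ⇒ Δ ++ φ ∷ ψ ∷ Δ') ∷ G) → ⊢ ((Γ ⇒ Δ ++ ψ ∷ φ ∷ Δ') ∷ G)
    cut  : ∀ {Γ₀ Δ₀ δ Γ₁ Δ₁ G} → ⊢ ((Γ₀ ⇒ Δ₀ ++ [ δ ]) ∷ G) → ⊢ ((δ ∷ Γ₁ ⇒ Δ₁) ∷ G)
          → ⊢ ((Γ₀ ++ Γ₁ ⇒ Δ₀ ++ Δ₁) ∷ G)
    ∧L₁  : ∀ {φ₁ φ₂ Γ Δ G} → ⊢ ((φ₁ ∷ Γ ⇒ Δ) ∷ G) → ⊢ ((φ₁ ∧ φ₂ ∷ Γ ⇒ Δ) ∷ G)
    ∧L₂  : ∀ {φ₁ φ₂ Γ Δ G} → ⊢ ((φ₂ ∷ Γ ⇒ Δ) ∷ G) → ⊢ ((φ₁ ∧ φ₂ ∷ Γ ⇒ Δ) ∷ G)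
    ∧R   : ∀ {φ₁ φ₂ Γ Δ G} → ⊢ ((Γ ⇒ Δ ++ [ φ₁ ]) ∷ G) → ⊢ ((Γ ⇒ Δ ++ [ φ₂ ]) ∷ G)
          → ⊢ ((Γ ⇒ Δ ++ [ φ₁ ∧ φ₂ ]) ∷ G)
    ∨L   : ∀ {φ₁ φ₂ Γ Δ G} → ⊢ ((φ₁ ∷ Γ ⇒ Δ) ∷ G) → ⊢ ((φ₂ ∷ Γ ⇒ Δ) ∷ G)
          → ⊢ ((φ₁ ∨ φ₂ ∷ Γ ⇒ Δ) ∷ G)
    ∨R₁  : ∀ {φ₁ φ₂ Γ Δ G} → ⊢ ((Γ ⇒ Δ ++ [ φ₁ ]) ∷ G) → ⊢ ((Γ ⇒ Δ ++ [ φ₁ ∨ φ₂ ]) ∷ G)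
    ∨R₂  : ∀ {φ₁ φ₂ Γ Δ G} → ⊢ ((Γ ⇒ Δ ++ [ φ₂ ]) ∷ G) → ⊢ ((Γ ⇒ Δ ++ [ φ₁ ∨ φ₂ ]) ∷ G)
    →L   : ∀ {φ ψ Γ Δ G} → ⊢ ((Γ ⇒ Δ ++ [ φ ]) ∷ G) → ⊢ ((ψ ∷ Γ ⇒ Δ) ∷ G)
          → ⊢ ((φ ⇒ᶠ ψ ∷ Γ ⇒ Δ) ∷ G)
    →R'  : ∀ {φ ψ Γ G} → ⊢ ((φ ∷ Γ ⇒ [ ψ ]) ∷ G) → ⊢ ((Γ ⇒ [ φ ⇒ᶠ ψ ]) ∷ G)
    ls   : ∀ {Γ₁ Γ₂ Δ G} → ⊢ ((Γ₁ ++ Γ₂ ⇒ Δ) ∷ G) → ⊢ ((Γ₁ ⇒ Δ) ∷ (Γ₂ ⇒ Δ) ∷ G)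

module HLJ'lsDerivations (C : HLJ'lsExtension) where
  open HLJ'lsExtension C

  Provable : Fml → Set
  Provable φ = ⊢ [ [] ⇒ [ φ ] ]

  exchangeL₀ : ∀ {a b Γ Δ G} → ⊢ ((a ∷ b ∷ Γ ⇒ Δ) ∷ G) → ⊢ ((b ∷ a ∷ Γ ⇒ Δ) ∷ G)
  exchangeL₀ = IEL {Γ = []}

  exchangeL₁ : ∀ {c a b Γ Δ G} → ⊢ ((c ∷ a ∷ b ∷ Γ ⇒ Δ) ∷ G) → ⊢ ((c ∷ b ∷ a ∷ Γ ⇒ Δ) ∷ G)
  exchangeL₁ {c} = IEL {Γ = [ c ]}

  weakenL₁ : ∀ {c a Γ Δ G} → ⊢ ((c ∷ Γ ⇒ Δ) ∷ G) → ⊢ ((c ∷ a ∷ Γ ⇒ Δ) ∷ G)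
  weakenL₁ d = exchangeL₀ (IWL d)

  hypothesis₁ : ∀ {a φ} → ⊢ [ a ∷ φ ∷ [] ⇒ [ φ ] ]
  hypothesis₁ = IWL ax

  hypothesis₂ : ∀ {φ a} → ⊢ [ φ ∷ a ∷ [] ⇒ [ φ ] ]
  hypothesis₂ = weakenL₁ ax

  weakenExternalʳ : ∀ {S T} → ⊢ [ S ] → ⊢ (S ∷ T ∷ [])
  weakenExternalʳ d = EE {G = []} {H = []} (EW d)

  -- →L with Δ = [ χ ]: χ is weakened into the left premise.
  →L₁ : ∀ {Γ φ ψ χ G} → ⊢ ((Γ ⇒ [ φ ]) ∷ G) → ⊢ ((ψ ∷ Γ ⇒ [ χ ]) ∷ G)
      → ⊢ ((φ ⇒ᶠ ψ ∷ Γ ⇒ [ χ ]) ∷ G)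
  →L₁ {χ = χ} d e = →L {Δ = [ χ ]} (IER {Δ = []} {Δ' = []} (IWR {φ = χ} d)) e

  →R-inverse : ∀ {a b} → Provable (a ⇒ᶠ b) → ⊢ [ a ∷ [] ⇒ [ b ] ]
  →R-inverse d = cut {Γ₀ = []} {Δ₀ = []} d (→L₁ ax hypothesis₂)

  modusPonens : ∀ {a b} → Provable (a ⇒ᶠ b) → Provable a → Provable b
  modusPonens d e = cut {Γ₀ = []} {Δ₀ = []} e (→R-inverse d)

  ⊢K : ∀ {φ ψ} → Provable (φ ⇒ᶠ (ψ ⇒ᶠ φ))
  ⊢K = →R' (→R' hypothesis₁)

  ⊢S : ∀ {φ ψ χ} → Provable ((φ ⇒ᶠ (ψ ⇒ᶠ χ)) ⇒ᶠ ((φ ⇒ᶠ ψ) ⇒ᶠ (φ ⇒ᶠ χ)))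
  ⊢S = →R' (→R' (→R' (exchangeL₁ (exchangeL₀
         (→L₁ hypothesis₂ (→L₁ ψ-from-φ (weakenL₁ (weakenL₁ ax))))))))
    where
      ψ-from-φ : ∀ {φ ψ} → ⊢ [ φ ∷ φ ⇒ᶠ ψ ∷ [] ⇒ [ ψ ] ]
      ψ-from-φ = exchangeL₀ (→L₁ ax hypothesis₂)

  ⊢∧E₁ : ∀ {φ ψ} → Provable ((φ ∧ ψ) ⇒ᶠ φ)
  ⊢∧E₁ = →R' (∧L₁ ax)

  ⊢∧E₂ : ∀ {φ ψ} → Provable ((φ ∧ ψ) ⇒ᶠ ψ)
  ⊢∧E₂ = →R' (∧L₂ ax)

  ⊢∧I : ∀ {φ ψ} → Provable (φ ⇒ᶠ (ψ ⇒ᶠ (φ ∧ ψ)))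
  ⊢∧I = →R' (→R' (∧R {Δ = []} hypothesis₁ hypothesis₂))

  ⊢∨I₁ : ∀ {φ ψ} → Provable (φ ⇒ᶠ (φ ∨ ψ))
  ⊢∨I₁ = →R' (∨R₁ {Δ = []} ax)

  ⊢∨I₂ : ∀ {φ ψ} → Provable (ψ ⇒ᶠ (φ ∨ ψ))
  ⊢∨I₂ = →R' (∨R₂ {Δ = []} ax)

  ⊢∨E : ∀ {φ ψ χ} → Provable ((φ ⇒ᶠ χ) ⇒ᶠ ((ψ ⇒ᶠ χ) ⇒ᶠ ((φ ∨ ψ) ⇒ᶠ χ)))
  ⊢∨E = →R' (→R' (→R' (∨L (exchangeL₁ (exchangeL₀ χ-from-φ)) (exchangeL₀ χ-from-φ))))
    where
      χ-from-φ : ∀ {φ χ a} → ⊢ [ φ ⇒ᶠ χ ∷ φ ∷ a ∷ [] ⇒ [ χ ] ]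
      χ-from-φ = →L₁ hypothesis₂ (weakenL₁ (weakenL₁ ax))

  ⊢efq : ∀ {φ} → Provable (⊥' ⇒ᶠ φ)
  ⊢efq = →R' ax⊥

  -- (ls) splits  φ , ψ ⇒ φ ∧ ψ  into  φ ⇒ φ ∧ ψ | ψ ⇒ φ ∧ ψ ; cutting each component
  -- against a projection leaves  φ ⇒ ψ | ψ ⇒ φ , and →R, ∨R and EC finish.
  ⊢lin : ∀ {φ ψ} → Provable ((φ ⇒ᶠ ψ) ∨ (ψ ⇒ᶠ φ))
  ⊢lin {φ} {ψ} = EC (∨R₁ {Δ = []} (→R' (EE {G = []} {H = []} (∨R₂ {Δ = []} (→R' φ⇒ψ∣ψ⇒φ)))))
    where
      split : ⊢ ((φ ∷ [] ⇒ [ φ ∧ ψ ]) ∷ (ψ ∷ [] ⇒ [ φ ∧ ψ ]) ∷ [])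
      split = ls {Γ₁ = [ φ ]} (∧R {Δ = []} hypothesis₂ hypothesis₁)

      φ⇒ψ∣ψ⇒φ∧ψ : ⊢ ((φ ∷ [] ⇒ [ ψ ]) ∷ (ψ ∷ [] ⇒ [ φ ∧ ψ ]) ∷ [])
      φ⇒ψ∣ψ⇒φ∧ψ = cut {Γ₀ = [ φ ]} {Δ₀ = []} {Γ₁ = []} split (weakenExternalʳ (∧L₂ ax))

      φ⇒ψ∣ψ⇒φ : ⊢ ((ψ ∷ [] ⇒ [ φ ]) ∷ (φ ∷ [] ⇒ [ ψ ]) ∷ [])
      φ⇒ψ∣ψ⇒φ = cut {Γ₀ = [ ψ ]} {Δ₀ = []} {Γ₁ = []} (EE {G = []} {H = []} φ⇒ψ∣ψ⇒φ∧ψ)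
                    (weakenExternalʳ (∧L₁ ax))

HLJ'ls : HLJ'lsExtension
HLJ'ls = record { Prop ; ⊢_ = Prop.HLJ'ls⊢_ }

∀HLJ'+∀Rms+ls : HLJ'lsExtension
∀HLJ'+∀Rms+ls = record { Pred ; ⊢_ = Pred.D⊢_ }

module _ where
  open HLJ'lsDerivations HLJ'ls
  open Prop using (GD⊢_; K; S; ∧E₁; ∧E₂; ∧I; ∨I₁; ∨I₂; ∨E; efq; lin; mp)

  GD⊢⇒HLJ'ls⊢ : ∀ {φ} → GD⊢ φ → Provable φ
  GD⊢⇒HLJ'ls⊢ K        = ⊢K
  GD⊢⇒HLJ'ls⊢ S        = ⊢S
  GD⊢⇒HLJ'ls⊢ ∧E₁      = ⊢∧E₁
  GD⊢⇒HLJ'ls⊢ ∧E₂      = ⊢∧E₂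
  GD⊢⇒HLJ'ls⊢ ∧I       = ⊢∧I
  GD⊢⇒HLJ'ls⊢ ∨I₁      = ⊢∨I₁
  GD⊢⇒HLJ'ls⊢ ∨I₂      = ⊢∨I₂
  GD⊢⇒HLJ'ls⊢ ∨E       = ⊢∨E
  GD⊢⇒HLJ'ls⊢ efq      = ⊢efq
  GD⊢⇒HLJ'ls⊢ lin      = ⊢lin
  GD⊢⇒HLJ'ls⊢ (mp d e) = modusPonens (GD⊢⇒HLJ'ls⊢ d) (GD⊢⇒HLJ'ls⊢ e)

module _ where
  open HLJ'lsDerivations ∀HLJ'+∀Rms+ls
  open Pred using (IL⊢_; K; S; ∧E₁; ∧E₂; ∧I; ∨I₁; ∨I₂; ∨E; efq; lin; mp; ∀E; ∃I; ∀I; ∃E)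
  open Pred.D⊢_ using (ax; →R'; ∀L; ∃R; ∀R; ∃L)

  IL⊢⇒D⊢ : ∀ {φ} → IL⊢ φ → Provable φ
  IL⊢⇒D⊢ K             = ⊢K
  IL⊢⇒D⊢ S             = ⊢S
  IL⊢⇒D⊢ ∧E₁           = ⊢∧E₁
  IL⊢⇒D⊢ ∧E₂           = ⊢∧E₂
  IL⊢⇒D⊢ ∧I            = ⊢∧I
  IL⊢⇒D⊢ ∨I₁           = ⊢∨I₁
  IL⊢⇒D⊢ ∨I₂           = ⊢∨I₂
  IL⊢⇒D⊢ ∨E            = ⊢∨E
  IL⊢⇒D⊢ efq           = ⊢efq
  IL⊢⇒D⊢ lin           = ⊢lin
  IL⊢⇒D⊢ (mp d e)      = modusPonens (IL⊢⇒D⊢ d) (IL⊢⇒D⊢ e)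
  IL⊢⇒D⊢ (∀E {t = t})  = →R' (∀L {t = t} ax)
  IL⊢⇒D⊢ (∃I {t = t})  = →R' (∃R {t = t} {Δ = []} ax)
  IL⊢⇒D⊢ (∀I d)        = →R' (∀R (→R-inverse (IL⊢⇒D⊢ d)))
  IL⊢⇒D⊢ (∃E d)        = →R' (∃L (→R-inverse (IL⊢⇒D⊢ d)))

mainTheorem4 : (∀ (φ : Prop.Fml) → Prop.GD⊢ φ → Prop.HLJ'ls⊢ [ (Prop._⇒_ [] [ φ ]) ])
    × (∀ (φ : Pred.Fml) → Pred.IL⊢ φ → Pred.D⊢ [ (Pred._⇒_ [] [ φ ]) ])
mainTheorem4 = (λ _ → GD⊢⇒HLJ'ls⊢) , (λ _ → IL⊢⇒D⊢)
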